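{- Let $C\in\mathcal{P}(n,d)$ with $\operatorname{st}(C)=\{j_1<\dots<j_\ell\}$. Then $\ell\le d\le n-\ell$ and $j_k\ge 2k$ for all $1\le k\le\ell$.
   Context: $\mathcal{P}(n,d)$ is the set of words of length $n$ in $\mathbf{e}$ and $\mathbf{n}$ with exactly $d$ letters $\mathbf{e}$. For $C\in\mathcal{P}(n,d)$, scan positions left to right and mark position $i$ with $C_i=\mathbf{e}$ if the number of $\mathbf{n}$'s at positions $<i$ equals the number of unmarked $\mathbf{e}$'s at positions $<i$; $\operatorname{st}(C)$ is the set of positions of unmarked $\mathbf{e}$'s. -}

module Defs where

open import Data.Nat using (ℕ; zero; suc; _+_)
open import Data.Nat.Properties using (_≟_)
open import Data.Vec using (Vec; []; _∷_)
open import Data.List using (List; []; _∷_)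
open import Relation.Nullary using (yes; no)
open import Data.Product using (Σ)
open import Relation.Binary.PropositionalEquality using (_≡_)

data Letter : Set where
  e n : Letter

countE : ∀ {m} → Vec Letter m → ℕ
countE [] = 0
countE (e ∷ w) = suc (countE w)
countE (n ∷ w) = countE w

P : ℕ → ℕ → Set
P len d = Σ (Vec Letter len) (λ C → countE C ≡ d)

-- Scan: i = current (1-based) position, nN = number of n's seen so far,
-- uE = number of unmarked e's seen so far.  Returns positions of unmarked e's
-- in increasing order.
stAux : ∀ {m} → ℕ → ℕ → ℕ → Vec Letter m → List ℕ
stAux i nN uE [] = []
stAux i nN uE (n ∷ w) = stAux (suc i) (suc nN) uE w
stAux i nN uE (e ∷ w) with nN ≟ uE
... | yes _ = stAux (suc i) nN uE w            -- marked
... | no  _ = i ∷ stAux (suc i) nN (suc uE) w  -- unmarked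

st : ∀ {m} → Vec Letter m → List ℕ
st = stAux 1 0 0

module Submission where

-- Every unmarked e is preceded by strictly more n's than unmarked e's (otherwise it would have
-- been marked), so the scan maintains "unmarked e's so far ≤ n's so far".  Hence the number ℓ of
-- unmarked e's is at most the number len − d of n's.  Moreover the k-th unmarked e is preceded by
-- k − 1 unmarked e's and at least k n's, so it sits at position at least 2k.

open import Defs
open import Data.Nat using (ℕ; suc; _*_; _∸_; _≤_; _<_; _+_; s≤s; z≤n)
open import Data.Nat.Properties
open import Data.Fin using (Fin; toℕ; zero; suc)
open import Data.List using (length; lookup)
open import Data.Product using (_×_; proj₁; _,_)
open import Data.Vec using (Vec; []; _∷_)
open import Relation.Nullary using (yes; no)
open import Relation.Binary.PropositionalEquality

countN : ∀ {m} → Vec Letter m → ℕ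
countN [] = 0
countN (e ∷ w) = countN w
countN (n ∷ w) = suc (countN w)

countE+countN≡length : ∀ {m} (w : Vec Letter m) → countE w + countN w ≡ m
countE+countN≡length [] = refl
countE+countN≡length (e ∷ w) = cong suc (countE+countN≡length w)
countE+countN≡length {suc m} (n ∷ w) =
  trans (+-suc (countE w) (countN w)) (cong suc (countE+countN≡length w))

length-stAux≤countE : ∀ {m} i nN uE (w : Vec Letter m) → length (stAux i nN uE w) ≤ countE w
length-stAux≤countE i nN uE [] = z≤n
length-stAux≤countE i nN uE (n ∷ w) = length-stAux≤countE (suc i) (suc nN) uE w
length-stAux≤countE i nN uE (e ∷ w) with nN ≟ uE
... | yes _ = m≤n⇒m≤1+n (length-stAux≤countE (suc i) nN uE w)
... | no _  = s≤s (length-stAux≤countE (suc i) nN (suc uE) w)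

unmarked<n's : ∀ {nN uE} → uE ≤ nN → nN ≢ uE → uE < nN
unmarked<n's uE≤nN nN≢uE = ≤∧≢⇒< uE≤nN (λ eq → nN≢uE (sym eq))

length-stAux≤countN : ∀ {m} i nN uE (w : Vec Letter m) → uE ≤ nN →
  uE + length (stAux i nN uE w) ≤ nN + countN w
length-stAux≤countN i nN uE [] uE≤nN = +-monoˡ-≤ 0 uE≤nN
length-stAux≤countN i nN uE (n ∷ w) uE≤nN =
  subst (uE + length (stAux (suc i) (suc nN) uE w) ≤_) (sym (+-suc nN (countN w)))
    (length-stAux≤countN (suc i) (suc nN) uE w (m≤n⇒m≤1+n uE≤nN))
length-stAux≤countN i nN uE (e ∷ w) uE≤nN with nN ≟ uE
... | yes _ = length-stAux≤countN (suc i) nN uE w uE≤nN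
... | no nN≢uE =
  subst (_≤ nN + countN w) (sym (+-suc uE (length (stAux (suc i) nN (suc uE) w))))
    (length-stAux≤countN (suc i) nN (suc uE) w (unmarked<n's uE≤nN nN≢uE))

double-suc≤ : ∀ {uE nN i} → uE < nN → nN + uE < i → 2 * suc uE ≤ i
double-suc≤ {uE} {nN} {i} uE<nN nN+uE<i = begin
  2 * suc uE            ≡⟨ cong (suc uE +_) (+-identityʳ (suc uE)) ⟩
  suc uE + suc uE       ≤⟨ +-monoˡ-≤ (suc uE) uE<nN ⟩
  nN + suc uE           ≡⟨ +-suc nN uE ⟩
  suc (nN + uE)         ≤⟨ nN+uE<i ⟩
  i                     ∎
  where open ≤-Reasoning

-- The invariant nN + uE < i holds because each of the i − 1 earlier positions carries
-- an n, an unmarked e, or a marked e.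
stAux-lookup≥ : ∀ {m} i nN uE (w : Vec Letter m) → uE ≤ nN → nN + uE < i →
  (k : Fin (length (stAux i nN uE w))) → 2 * suc (uE + toℕ k) ≤ lookup (stAux i nN uE w) k
stAux-lookup≥ i nN uE (n ∷ w) uE≤nN nN+uE<i k =
  stAux-lookup≥ (suc i) (suc nN) uE w (m≤n⇒m≤1+n uE≤nN) (s≤s nN+uE<i) k
stAux-lookup≥ i nN uE (e ∷ w) uE≤nN nN+uE<i k with nN ≟ uE
... | yes _ = stAux-lookup≥ (suc i) nN uE w uE≤nN (m≤n⇒m≤1+n nN+uE<i) k
... | no nN≢uE with k
...   | zero = subst (λ x → 2 * suc x ≤ i) (sym (+-identityʳ uE))
                 (double-suc≤ (unmarked<n's uE≤nN nN≢uE) nN+uE<i)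
...   | suc k =
  subst (λ x → 2 * suc x ≤ lookup (stAux (suc i) nN (suc uE) w) k) (sym (+-suc uE (toℕ k)))
    (stAux-lookup≥ (suc i) nN (suc uE) w (unmarked<n's uE≤nN nN≢uE)
      (subst (_< suc i) (sym (+-suc nN uE)) (s≤s nN+uE<i)) k)

lemma4p12 : (len d : ℕ) → (C : P len d) →
    length (st (proj₁ C)) ≤ d × d ≤ len ∸ length (st (proj₁ C)) ×
      ((k : Fin (length (st (proj₁ C)))) → 2 * suc (toℕ k) ≤ lookup (st (proj₁ C)) k)
lemma4p12 len d (C , refl) =
  length-stAux≤countE 1 0 0 C ,
  d≤len∸ℓ ,
  stAux-lookup≥ 1 0 0 C z≤n (s≤s z≤n)
  where
  d≤len∸ℓ : countE C ≤ len ∸ length (st C)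
  d≤len∸ℓ = m+n≤o⇒m≤o∸n (countE C) (begin
    countE C + length (st C) ≤⟨ +-monoʳ-≤ (countE C) (length-stAux≤countN 1 0 0 C z≤n) ⟩
    countE C + countN C      ≡⟨ countE+countN≡length C ⟩
    len                      ∎)
    where open ≤-Reasoning
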